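{- For every integer $n\geq0$, $$P_n=Q_n+Q_{n-1},\qquad (x-1)Q_n=P_{n+1}+P_n.$$
   Context: Fibonacci product polynomials: for $n\geq1$, $P_n(x)$ is the characteristic polynomial $\det(xI-M)$ of the $n\times n$ tridiagonal matrix with all sub- and superdiagonal entries $1$ and diagonal $(2,3,\dots,3)$, and $Q_n(x)$ that of the $n\times n$ tridiagonal matrix with sub- and superdiagonal entries $1$ and all diagonal entries $3$; $P_0=Q_0=1$, and $Q_{ -1}=0$. -}

module Defs where

open import Data.Nat as ℕ using (ℕ; zero; suc; ∣_-_∣)
open import Data.Integer using (ℤ; +_; _+_; _*_; _-_; -_)
open import Data.Fin using (Fin; zero; suc; toℕ; punchIn)
open import Data.Bool using (if_then_else_)
open import Relation.Nullary using (does)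

Matrix : ℕ → Set
Matrix n = Fin n → Fin n → ℤ

∑ : ∀ n → (Fin n → ℤ) → ℤ
∑ zero    f = + 0
∑ (suc n) f = f zero + ∑ n (λ j → f (suc j))

sign : ℕ → ℤ
sign zero          = + 1
sign (suc zero)    = - (+ 1)
sign (suc (suc k)) = sign k

det : ∀ n → Matrix n → ℤ
det zero    A = + 1
det (suc n) A =
  ∑ (suc n) (λ j → sign (toℕ j) * A zero j *
                   det n (λ i k → A (suc i) (punchIn j k)))

tridiag : ∀ n → (Fin n → ℤ) → Matrix n
tridiag n d i j =
  if does (toℕ i ℕ.≟ toℕ j) then d i
  else if does (∣ toℕ i - toℕ j ∣ ℕ.≟ 1) then + 1 else + 0

diagP : ∀ n → Fin n → ℤ
diagP n zero    = + 2
diagP n (suc _) = + 3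

diagQ : ∀ n → Fin n → ℤ
diagQ n _ = + 3

charPoly : ∀ n → Matrix n → ℤ → ℤ
charPoly n M x =
  det n (λ i j → (if does (toℕ i ℕ.≟ toℕ j) then x else + 0) - M i j)

P : ℕ → ℤ → ℤ
P n = charPoly n (tridiag n (diagP n))

Q : ℕ → ℤ → ℤ
Q n = charPoly n (tridiag n (diagQ n))

-- Q_{n-1}, with the convention Q_{-1} = 0.
Qprev : ℕ → ℤ → ℤ
Qprev zero    x = + 0
Qprev (suc n) x = Q n x

{-# OPTIONS --safe #-}
module Submission where

-- Expanding along the first row, the characteristic polynomial D(d) of a tridiagonal matrix
-- with unit off-diagonals and diagonal d satisfies D(d) = (x - d₀) D(tail d) - D(tail² d).
-- P and Q differ only in the first diagonal entry (2 versus 3), so both expand to the same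
-- tail: P_{n+1} = (x - 2) Q_n - Q_{n-1} and Q_{n+1} = (x - 3) Q_n - Q_{n-1}. Subtracting gives
-- P_{n+1} = Q_{n+1} + Q_n, and adding P_n = Q_n + Q_{n-1} to the expansion of P_{n+1}
-- gives P_{n+1} + P_n = (x - 1) Q_n.

open import Defs
open import Data.Nat as ℕ using (ℕ; suc; zero)
open import Data.Bool using (if_then_else_)
open import Relation.Nullary using (does)
open import Data.Integer using (ℤ; +_; _+_; _*_; _-_; -_)
open import Data.Integer.Properties using (*-zeroˡ; *-zeroʳ; *-identityˡ; *-identityʳ; +-identityʳ; *-assoc)
open import Data.Integer.Tactic.RingSolver using (solve-∀)
open import Data.Fin using (Fin; zero; suc; toℕ; punchIn)
open import Data.Product using (_×_; _,_)
open import Relation.Binary.PropositionalEquality using (_≡_; refl; cong; cong₂; sym; trans; module ≡-Reasoning)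

open ≡-Reasoning

minor : ∀ {n} → Matrix (suc n) → Fin (suc n) → Matrix n
minor A j i k = A (suc i) (punchIn j k)

∑-zero : ∀ n {f : Fin n → ℤ} → (∀ j → f j ≡ + 0) → ∑ n f ≡ + 0
∑-zero zero    f≡0 = refl
∑-zero (suc n) f≡0 = cong₂ _+_ (f≡0 zero) (∑-zero n (λ j → f≡0 (suc j)))

det₁ : (A : Matrix 1) → det 1 A ≡ A zero zero
det₁ A = begin
  + 1 * A zero zero * + 1 + + 0 ≡⟨ +-identityʳ (+ 1 * A zero zero * + 1) ⟩
  + 1 * A zero zero * + 1       ≡⟨ *-identityʳ (+ 1 * A zero zero) ⟩
  + 1 * A zero zero             ≡⟨ *-identityˡ (A zero zero) ⟩
  A zero zero                   ∎

expansionTerm : ∀ {n} → Matrix (suc n) → Fin (suc n) → ℤ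
expansionTerm {n} A j = sign (toℕ j) * A zero j * det n (minor A j)

mutual
  det-zeroFirstColumn : ∀ n (A : Matrix (suc n)) →
    (∀ i → A i zero ≡ + 0) → det (suc n) A ≡ + 0
  det-zeroFirstColumn n A A·0≡0 = begin
    det (suc n) A                       ≡⟨ det-firstColumnZeroBelowTop n A (λ i → A·0≡0 (suc i)) ⟩
    A zero zero * det n (minor A zero)  ≡⟨ cong (_* det n (minor A zero)) (A·0≡0 zero) ⟩
    + 0 * det n (minor A zero)          ≡⟨ *-zeroˡ (det n (minor A zero)) ⟩
    + 0                                 ∎

  det-firstColumnZeroBelowTop : ∀ n (A : Matrix (suc n)) →
    (∀ i → A (suc i) zero ≡ + 0) → det (suc n) A ≡ A zero zero * det n (minor A zero)
  det-firstColumnZeroBelowTop n A A₊0≡0 = begin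
    + 1 * A zero zero * det n (minor A zero) + ∑ n (λ j → expansionTerm A (suc j))
      ≡⟨ cong₂ _+_ (cong (_* det n (minor A zero)) (*-identityˡ (A zero zero)))
                   (∑-expansionTerm-suc-zero n A A₊0≡0) ⟩
    A zero zero * det n (minor A zero) + + 0
      ≡⟨ +-identityʳ (A zero zero * det n (minor A zero)) ⟩
    A zero zero * det n (minor A zero) ∎

  ∑-expansionTerm-suc-zero : ∀ n (A : Matrix (suc n)) → (∀ i → A (suc i) zero ≡ + 0) →
    ∑ n (λ j → expansionTerm A (suc j)) ≡ + 0
  ∑-expansionTerm-suc-zero zero    A _ = refl
  ∑-expansionTerm-suc-zero (suc n) A A₊0≡0 = ∑-zero (suc n) λ j → begin
    sign (toℕ (suc j)) * A zero (suc j) * det (suc n) (minor A (suc j))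
      ≡⟨ cong (sign (toℕ (suc j)) * A zero (suc j) *_)
              (det-zeroFirstColumn n (minor A (suc j)) A₊0≡0) ⟩
    sign (toℕ (suc j)) * A zero (suc j) * + 0
      ≡⟨ *-zeroʳ (sign (toℕ (suc j)) * A zero (suc j)) ⟩
    + 0 ∎

expansionTerm-zero : ∀ {n} (A : Matrix (suc n)) j → A zero j ≡ + 0 → expansionTerm A j ≡ + 0
expansionTerm-zero {n} A j A0j≡0 = begin
  sign (toℕ j) * A zero j * det n (minor A j)  ≡⟨ cong (λ a → sign (toℕ j) * a * det n (minor A j)) A0j≡0 ⟩
  sign (toℕ j) * + 0 * det n (minor A j)       ≡⟨ cong (_* det n (minor A j)) (*-zeroʳ (sign (toℕ j))) ⟩
  + 0 * det n (minor A j)                      ≡⟨ *-zeroˡ (det n (minor A j)) ⟩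
  + 0                                          ∎

det-firstRowZeroBeyondSecond : ∀ n (A : Matrix (suc (suc n))) →
  (∀ k → A zero (suc (suc k)) ≡ + 0) →
  det (suc (suc n)) A ≡ A zero zero * det (suc n) (minor A zero)
                        - A zero (suc zero) * det (suc n) (minor A (suc zero))
det-firstRowZeroBeyondSecond n A A0₊₊≡0 = begin
  + 1 * a * X + (- (+ 1) * b * Y + ∑ n (λ j → expansionTerm A (suc (suc j))))
    ≡⟨ cong (λ s → + 1 * a * X + (- (+ 1) * b * Y + s))
            (∑-zero n (λ j → expansionTerm-zero A (suc (suc j)) (A0₊₊≡0 j))) ⟩
  + 1 * a * X + (- (+ 1) * b * Y + + 0)
    ≡⟨ twoTermExpansion a b X Y ⟩
  a * X - b * Y ∎
  where
  a = A zero zero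
  b = A zero (suc zero)
  X = det (suc n) (minor A zero)
  Y = det (suc n) (minor A (suc zero))
  twoTermExpansion : ∀ a b X Y → + 1 * a * X + (- (+ 1) * b * Y + + 0) ≡ a * X - b * Y
  twoTermExpansion = solve-∀

det-tridiagonalCorner : ∀ n (A : Matrix (suc (suc n))) →
  (∀ k → A zero (suc (suc k)) ≡ + 0) → (∀ i → A (suc (suc i)) zero ≡ + 0) →
  det (suc (suc n)) A ≡ A zero zero * det (suc n) (minor A zero)
                        - A zero (suc zero) * A (suc zero) zero
                          * det n (λ i k → A (suc (suc i)) (suc (suc k)))
det-tridiagonalCorner n A A0₊₊≡0 A₊₊0≡0 = begin
  det (suc (suc n)) A
    ≡⟨ det-firstRowZeroBeyondSecond n A A0₊₊≡0 ⟩
  a * X - b * det (suc n) (minor A (suc zero))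
    ≡⟨ cong (λ y → a * X - b * y) (det-firstColumnZeroBelowTop n (minor A (suc zero)) A₊₊0≡0) ⟩
  a * X - b * (c * Z)
    ≡⟨ cong (λ y → a * X - y) (sym (*-assoc b c Z)) ⟩
  a * X - b * c * Z ∎
  where
  a = A zero zero
  b = A zero (suc zero)
  c = A (suc zero) zero
  X = det (suc n) (minor A zero)
  Z = det n (λ i k → A (suc (suc i)) (suc (suc k)))

charMatrix : ∀ n → Matrix n → ℤ → Matrix n
charMatrix n M x i j = (if does (toℕ i ℕ.≟ toℕ j) then x else + 0) - M i j

tridiagCharPoly : ∀ n → (Fin n → ℤ) → ℤ → ℤ
tridiagCharPoly n d x = det n (charMatrix n (tridiag n d) x)

tridiagCharPoly-1 : ∀ d x → tridiagCharPoly 1 d x ≡ x - d zero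
tridiagCharPoly-1 d x = det₁ (charMatrix 1 (tridiag 1 d) x)

tridiagCharPoly-suc-suc : ∀ n d x →
  tridiagCharPoly (suc (suc n)) d x
    ≡ (x - d zero) * tridiagCharPoly (suc n) (λ i → d (suc i)) x
      - tridiagCharPoly n (λ i → d (suc (suc i))) x
-- The band conditions hold by computation, and (+ 0 - + 1) * (+ 0 - + 1) normalises to + 1.
tridiagCharPoly-suc-suc n d x = begin
  tridiagCharPoly (suc (suc n)) d x
    ≡⟨ det-tridiagonalCorner n (charMatrix (suc (suc n)) (tridiag (suc (suc n)) d) x) (λ _ → refl) (λ _ → refl) ⟩
  (x - d zero) * tridiagCharPoly (suc n) (λ i → d (suc i)) x - + 1 * D
    ≡⟨ cong (λ y → (x - d zero) * tridiagCharPoly (suc n) (λ i → d (suc i)) x - y) (*-identityˡ D) ⟩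
  (x - d zero) * tridiagCharPoly (suc n) (λ i → d (suc i)) x - D ∎
  where
  D = tridiagCharPoly n (λ i → d (suc (suc i))) x

a≡a*1-0 : ∀ a → a ≡ a * + 1 - + 0
a≡a*1-0 = solve-∀

-- The tail of diagP (2 + n) is definitionally diagQ (1 + n).
P-suc : ∀ n x → P (suc n) x ≡ (x - + 2) * Q n x - Qprev n x
P-suc zero    x = trans (tridiagCharPoly-1 (diagP 1) x) (a≡a*1-0 (x - + 2))
P-suc (suc n) x = tridiagCharPoly-suc-suc n (diagP (suc (suc n))) x

Q-suc : ∀ n x → Q (suc n) x ≡ (x - + 3) * Q n x - Qprev n x
Q-suc zero    x = trans (tridiagCharPoly-1 (diagQ 1) x) (a≡a*1-0 (x - + 3))
Q-suc (suc n) x = tridiagCharPoly-suc-suc n (diagQ (suc (suc n))) x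

P≡Q+Qprev : ∀ n x → P n x ≡ Q n x + Qprev n x
P≡Q+Qprev zero    x = refl
P≡Q+Qprev (suc n) x = begin
  P (suc n) x                                 ≡⟨ P-suc n x ⟩
  (x - + 2) * Q n x - Qprev n x               ≡⟨ cornerShift x (Q n x) (Qprev n x) ⟩
  ((x - + 3) * Q n x - Qprev n x) + Q n x     ≡⟨ cong (_+ Q n x) (sym (Q-suc n x)) ⟩
  Q (suc n) x + Q n x                         ∎
  where
  cornerShift : ∀ x q q′ → (x - + 2) * q - q′ ≡ ((x - + 3) * q - q′) + q
  cornerShift = solve-∀

[x-1]*Q≡P[1+n]+P : ∀ n x → (x - + 1) * Q n x ≡ P (suc n) x + P n x
[x-1]*Q≡P[1+n]+P n x = begin
  (x - + 1) * Q n x                                    ≡⟨ regroup x (Q n x) (Qprev n x) ⟩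
  ((x - + 2) * Q n x - Qprev n x) + (Q n x + Qprev n x) ≡⟨ sym (cong₂ _+_ (P-suc n x) (P≡Q+Qprev n x)) ⟩
  P (suc n) x + P n x                                  ∎
  where
  regroup : ∀ x q q′ → (x - + 1) * q ≡ ((x - + 2) * q - q′) + (q + q′)
  regroup = solve-∀

lemma4p11 : (n : ℕ) (x : ℤ) →
    (P n x ≡ Q n x + Qprev n x) × ((x - + 1) * Q n x ≡ P (suc n) x + P n x)
lemma4p11 n x = P≡Q+Qprev n x , [x-1]*Q≡P[1+n]+P n x
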